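{- Let $T_1$ and $T_2$ be tournaments such that $T_1$ is switching isomorphic to $T_2$. Then (i) $T_1$ is a CR tournament if and only if $T_2$ is a CR tournament; (ii) $T_1$ is a strong CR tournament if and only if $T_2$ is a strong CR tournament; (iii) $T_1$ is a basic tournament if and only if $T_2$ is a basic tournament; (iv) $T_1$ is a basic CR tournament if and only if $T_2$ is a basic CR tournament; (v) $T_1$ is a basic strong CR tournament if and only if $T_2$ is a basic strong CR tournament.
   Context: A tournament is a digraph with exactly one arc between each pair of distinct vertices. For distinct vertices write $\theta_T(u,v)=1$ if $u\to v$, $-1$ otherwise. Skew-adjacency matrix $S_T$: entry $1$ if $v_i\to v_j$, $-1$ if $v_j\to v_i$, $0$ on the diagonal; $\det(T)=\det(S_T)$. For odd $k\ge1$, $\mathcal{D}_k$ is the set of tournaments all of whose induced subtournaments have determinant at most $k^2$; $\mathcal{D}_{ -1}=\emptyset$. The switch of $T$ w.r.t. $W\subseteq V(T)$ reverses all arcs between $W$ and $V(T)\setminus W$; $T_1$ is switching isomorphic to $T_2$ if some switch of $T_1$ is isomorphic to $T_2$. A diamond is a 4-tournament consisting of a 3-cycle plus a vertex dominating all of it or dominated by all of it. A 1-transitive blowup of $T$ (vertices $v_1,\dots,v_n$) is obtained by replacing one vertex $v_i$ by two vertices $x\to y$, each having the same relation to every $v_j$ ($j\ne i$) as $v_i$ had. Two vertices $u_1,u_2$ of $T$ are covertices and revertices if $|V(T)|=2$; if $|V(T)|\ge3$ they are covertices if $\theta_T(u_1,v)=\theta_T(u_2,v)$ for all other $v$, revertices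 if $\theta_T(u_1,v)=-\theta_T(u_2,v)$ for all other $v$; CR-associated if covertices or revertices. For $u\notin V(T)=\{w_1,\dots,w_n\}$ and $\sigma=(r_1,\dots,r_n)\in\{\pm1\}^n$, $T(u,\sigma)$ extends $T$ by $u$ with $u\to w_i$ iff $r_i=1$; $u$ is a CR vertex for $T$ with $\sigma$ if $u$ is CR-associated in $T(u,\sigma)$ with some vertex of $T$, otherwise a non-CR vertex. Let $T\in\mathcal{D}_k\setminus\mathcal{D}_{k-2}$ for some odd $k$. $T$ is a CR tournament if $T$ is a 1-tournament, a 2-tournament or a diamond, or else for every $u\notin V(T)$ and every $\sigma$ with $u$ a non-CR vertex for $T$ with $\sigma$, $T(u,\sigma)\notin\mathcal{D}_k$. A strong CR tournament is a CR tournament all of whose 1-transitive blowups are CR tournaments. A tournament of order at least $4$ is basic if no two of its vertices are CR-associated; a basic (strong) CR tournament is a basic tournament that is a (strong) CR tournament. -}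

module Defs where

open import Data.Nat using (ℕ; zero; suc; _*_; _≥_)
open import Data.Bool using (Bool; true; false; not; if_then_else_; _xor_)
open import Data.Fin using (Fin; zero; suc; toℕ; punchIn; _≟_)
open import Data.Integer as ℤ using (ℤ; +_; -_)
open import Data.Product using (Σ; _×_; _,_; ∃; ∃-syntax)
open import Data.Sum using (_⊎_)
open import Data.Empty using (⊥; ⊥-elim)
open import Relation.Nullary using (¬_; yes; no)
open import Relation.Binary.PropositionalEquality using (_≡_; _≢_; refl; sym; cong)
open import Function.Bundles using (_↔_; Inverse)
open import Function.Definitions using (Injective)

record Tournament (n : ℕ) : Set where
  field
    beats   : Fin n → Fin n → Bool
    irrefl  : ∀ i → beats i i ≡ false
    antisym : ∀ i j → i ≢ j → beats j i ≡ not (beats i j)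
open Tournament public

sumFin : ∀ {n} → (Fin n → ℤ) → ℤ
sumFin {zero}  f = + 0
sumFin {suc n} f = f zero ℤ.+ sumFin (λ j → f (suc j))

signFin : ∀ {n} → Fin n → ℤ
signFin zero    = + 1
signFin (suc j) = - signFin j

det : ∀ {n} → (Fin n → Fin n → ℤ) → ℤ
det {zero}  M = + 1
det {suc n} M =
  sumFin (λ j → signFin j ℤ.* (M zero j ℤ.* det (λ r c → M (suc r) (punchIn j c))))

skew : ∀ {n} → Tournament n → Fin n → Fin n → ℤ
skew T i j with i ≟ j
... | yes _ = + 0
... | no  _ = if beats T i j then + 1 else - (+ 1)

-- det of the subtournament induced on the image of an injection f
-- (independent of the ordering of the image)
detInduced : ∀ {n m} → Tournament n → (Fin m → Fin n) → ℤ
detInduced T f = det (λ a b → skew T (f a) (f b))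

-- The classes D_k, with k = 2m+1 odd, and D_{-1} = ∅.

oddK : ℕ → ℕ
oddK m = suc (2 * m)

InD : ℕ → ∀ {n} → Tournament n → Set
InD m {n} T = ∀ r (f : Fin r → Fin n) → Injective _≡_ _≡_ f →
              detInduced T f ℤ.≤ + (oddK m * oddK m)

InDprev : ℕ → ∀ {n} → Tournament n → Set
InDprev zero    T = ⊥
InDprev (suc m) T = InD m T

Level : ℕ → ∀ {n} → Tournament n → Set
Level m T = InD m T × ¬ InDprev m T

switch : ∀ {n} → Tournament n → (Fin n → Bool) → Tournament n
switch {n} T W = record { beats = b ; irrefl = ir ; antisym = as }
  where
  b : Fin n → Fin n → Bool
  b i j = if W i xor W j then not (beats T i j) else beats T i j
  xor-self : ∀ x → x xor x ≡ false
  xor-self false = refl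
  xor-self true  = refl
  ir : ∀ i → b i i ≡ false
  ir i rewrite xor-self (W i) = irrefl T i
  xor-comm : ∀ x y → x xor y ≡ y xor x
  xor-comm false false = refl
  xor-comm false true  = refl
  xor-comm true  false = refl
  xor-comm true  true  = refl
  as : ∀ i j → i ≢ j → b j i ≡ not (b i j)
  as i j i≢j rewrite xor-comm (W j) (W i) | antisym T i j i≢j with W i xor W j
  ... | true  = refl
  ... | false = refl

Isomorphic : ∀ {n₁ n₂} → Tournament n₁ → Tournament n₂ → Set
Isomorphic {n₁} {n₂} T₁ T₂ =
  Σ (Fin n₁ ↔ Fin n₂) λ φ →
    ∀ i j → beats T₂ (Inverse.to φ i) (Inverse.to φ j) ≡ beats T₁ i j

SwitchingIsomorphic : ∀ {n₁ n₂} → Tournament n₁ → Tournament n₂ → Set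
SwitchingIsomorphic {n₁} T₁ T₂ =
  Σ (Fin n₁ → Bool) λ W → Isomorphic (switch T₁ W) T₂

-- Covertices / revertices.  For n = 2 both conditions hold vacuously,
-- matching the convention of the paper.

Covertices : ∀ {n} → Tournament n → Fin n → Fin n → Set
Covertices {n} T u₁ u₂ =
  u₁ ≢ u₂ × (∀ (v : Fin n) → v ≢ u₁ → v ≢ u₂ → beats T u₁ v ≡ beats T u₂ v)

Revertices : ∀ {n} → Tournament n → Fin n → Fin n → Set
Revertices {n} T u₁ u₂ =
  u₁ ≢ u₂ × (∀ (v : Fin n) → v ≢ u₁ → v ≢ u₂ → beats T u₁ v ≡ not (beats T u₂ v))

CRAssociated : ∀ {n} → Tournament n → Fin n → Fin n → Set
CRAssociated T u₁ u₂ = Covertices T u₁ u₂ ⊎ Revertices T u₁ u₂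

-- One-vertex extension T(u,σ): the new vertex u is `zero`, the old
-- vertex w_i is `suc i`, and u → w_i iff σ i = true.

extend : ∀ {n} → Tournament n → (Fin n → Bool) → Tournament (suc n)
extend {n} T σ = record { beats = b ; irrefl = ir ; antisym = as }
  where
  b : Fin (suc n) → Fin (suc n) → Bool
  b zero    zero    = false
  b zero    (suc j) = σ j
  b (suc i) zero    = not (σ i)
  b (suc i) (suc j) = beats T i j
  ir : ∀ i → b i i ≡ false
  ir zero    = refl
  ir (suc i) = irrefl T i
  notnot : ∀ x → x ≡ not (not x)
  notnot false = refl
  notnot true  = refl
  as : ∀ i j → i ≢ j → b j i ≡ not (b i j)
  as zero    zero    p = ⊥-elim (p refl)
  as zero    (suc j) p = refl
  as (suc i) zero    p = notnot (σ i)
  as (suc i) (suc j) p = antisym T i j (λ e → p (cong suc e))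

NonCRVertex : ∀ {n} → Tournament n → (Fin n → Bool) → Set
NonCRVertex T σ = ∀ i → ¬ CRAssociated (extend T σ) zero (suc i)

Diamond : ∀ {n} → Tournament n → Set
Diamond {n} T =
  Σ (Fin n) λ a → Σ (Fin n) λ b → Σ (Fin n) λ c → Σ (Fin n) λ d →
    a ≢ b × a ≢ c × a ≢ d × b ≢ c × b ≢ d × c ≢ d ×
    (∀ x → x ≡ a ⊎ x ≡ b ⊎ x ≡ c ⊎ x ≡ d) ×
    beats T a b ≡ true × beats T b c ≡ true × beats T c a ≡ true ×
    ((beats T d a ≡ true × beats T d b ≡ true × beats T d c ≡ true) ⊎
     (beats T a d ≡ true × beats T b d ≡ true × beats T c d ≡ true))

IsCR : ∀ {n} → Tournament n → Set
IsCR {n} T = ∃[ m ] (Level m T ×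
  (n ≡ 1 ⊎ n ≡ 2 ⊎ Diamond T ⊎
   (∀ (σ : Fin n → Bool) → NonCRVertex T σ → ¬ InD m (extend T σ))))

-- 1-transitive blowup at vertex i: v_i is replaced by x = zero and
-- y = suc i with x → y; every other v_j is suc j.
blowup : ∀ {n} → Tournament n → Fin n → Tournament (suc n)
blowup {n} T i = record { beats = b ; irrefl = ir ; antisym = as }
  where
  b : Fin (suc n) → Fin (suc n) → Bool
  b zero    zero    = false
  b zero    (suc j) with j ≟ i
  ... | yes _ = true
  ... | no  _ = beats T i j
  b (suc j) zero    with j ≟ i
  ... | yes _ = false
  ... | no  _ = beats T j i
  b (suc j) (suc k) = beats T j k
  ir : ∀ j → b j j ≡ false
  ir zero    = refl
  ir (suc j) = irrefl T j
  as : ∀ j k → j ≢ k → b k j ≡ not (b j k)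
  as zero    zero    p = ⊥-elim (p refl)
  as zero    (suc k) p with k ≟ i
  ... | yes _  = refl
  ... | no k≢i = antisym T i k (λ e → k≢i (sym e))
  as (suc j) zero    p with j ≟ i
  ... | yes _  = refl
  ... | no j≢i = antisym T j i j≢i
  as (suc j) (suc k) p = antisym T j k (λ e → p (cong suc e))

IsStrongCR : ∀ {n} → Tournament n → Set
IsStrongCR {n} T = IsCR T × (∀ (i : Fin n) → IsCR (blowup T i))

IsBasic : ∀ {n} → Tournament n → Set
IsBasic {n} T = n ≥ 4 × (∀ (u v : Fin n) → ¬ CRAssociated T u v)

IsBasicCR : ∀ {n} → Tournament n → Set
IsBasicCR T = IsBasic T × IsCR T

IsBasicStrongCR : ∀ {n} → Tournament n → Set
IsBasicStrongCR T = IsBasic T × IsStrongCR T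

-- Write θ for the ±1 arc function and ε_i = -1 exactly when i ∈ W. A switching isomorphism
-- T₁ → T₂ is a bijection π with θ₂(π i, π j) = ε_i ε_j θ₁(i, j), and every notion in the
-- theorem is invariant under such maps. The skew matrix of an induced subtournament of T₂ is
-- that of T₁ conjugated by the ±1 diagonal matrix ε, so all these determinants, hence the
-- classes D_k, agree. Covertices and revertices stay CR-associated (they trade kinds when
-- exactly one of them is switched). Extending π by one unswitched new vertex matches the
-- one-vertex extensions of T₁ and T₂, and π matches their 1-transitive blowups. A diamond
-- has four vertices, so that each of its switches is again a diamond is a finite check.
-- Finally, the inverse of a switching isomorphism is again one.

{-# OPTIONS --safe #-}
module Submission where

open import Defs
open import Data.Nat as ℕ using (ℕ; zero; suc)
open import Data.Bool as Bool using (Bool; true; false; not; _xor_; if_then_else_)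
open import Data.Bool.Properties using (xor-∧-commutativeRing; xor-assoc; xor-same)
open import Data.Fin using (Fin; zero; suc; punchIn; _≟_)
open import Data.Fin.Patterns using (0F; 1F; 2F; 3F)
open import Data.Fin.Permutation using (Permutation; _⟨$⟩ʳ_; _⟨$⟩ˡ_; inverseˡ; inverseʳ; flip; lift₀; ↔⇒≡)
open import Data.Fin.Properties using (any?; all?)
open import Data.Integer as ℤ using (ℤ; +_; -_; _*_; 1ℤ)
open import Data.Integer.Properties using (+-*-semiring; *-1-commutativeMonoid; *-assoc; *-identityˡ)
open import Data.Integer.Tactic.RingSolver using (solve-∀)
open import Data.Product as Product using (Σ; _×_; _,_; ∃)
open import Data.Sum as Sum using (_⊎_; inj₁; inj₂)
open import Data.Vec using (Vec; []; _∷_; lookup; map)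
open import Data.Vec.Properties using (lookup-map)
import Data.Vec.Functional as Vector
open import Data.Vec.Membership.Propositional using (_∈_)
open import Data.Vec.Relation.Unary.All using ([]; _∷_)
open import Data.Vec.Relation.Unary.Any using (here; there; index)
open import Data.Vec.Relation.Unary.Any.Properties using (lookup-index)
open import Data.Vec.Relation.Unary.AllPairs using ([]; _∷_)
open import Data.Vec.Relation.Unary.Unique.Propositional using (Unique)
open import Data.Vec.Relation.Unary.Unique.Propositional.Properties using (lookup-injective)
open import Algebra.Properties.Semiring.Sum +-*-semiring using (sum; sum-cong-≗; *-distribˡ-sum)
open import Algebra.Properties.CommutativeMonoid.Sum *-1-commutativeMonoid
  using ()
  renaming (sum to product; sum-cong-≗ to product-cong-≗; sum-remove to product-remove;
            ∑-distrib-+ to product-distrib-*; sum-replicate-zero to product-replicate-one)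
open import Algebra.Solver.Ring.AlmostCommutativeRing using (fromCommutativeRing)
open import Algebra.Solver.Ring.Simple (fromCommutativeRing xor-∧-commutativeRing) Bool._≟_
  using (solve; _:+_; _:=_; con)
open import Function using (_∘_; _⇔_; mk⇔)
open import Function.Definitions using (Injective; StrictlySurjective)
open import Relation.Nullary using (¬_; Dec; yes; no; contradiction)
open import Relation.Nullary.Decidable using (_×-dec_; _⊎-dec_; ¬?; from-yes)
open import Relation.Binary.PropositionalEquality

-- Determinants

sumFin≡sum : ∀ {n} (f : Fin n → ℤ) → sumFin f ≡ sum f
sumFin≡sum {zero}  f = refl
sumFin≡sum {suc n} f = cong (λ x → f zero ℤ.+ x) (sumFin≡sum (f ∘ suc))

sumFin-cong : ∀ {n} {f g : Fin n → ℤ} → (∀ j → f j ≡ g j) → sumFin f ≡ sumFin g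
sumFin-cong {f = f} {g} f≗g = trans (sumFin≡sum f) (trans (sum-cong-≗ f≗g) (sym (sumFin≡sum g)))

*-distribˡ-sumFin : ∀ {n} k (f : Fin n → ℤ) → k * sumFin f ≡ sumFin (λ j → k * f j)
*-distribˡ-sumFin k f = begin
  k * sumFin f              ≡⟨ cong (k *_) (sumFin≡sum f) ⟩
  k * sum f                 ≡⟨ *-distribˡ-sum k f ⟩
  sum (λ j → k * f j)       ≡⟨ sumFin≡sum (λ j → k * f j) ⟨
  sumFin (λ j → k * f j)    ∎
  where open ≡-Reasoning

minor : ∀ {n} → (Fin (suc n) → Fin (suc n) → ℤ) → Fin (suc n) → Fin n → Fin n → ℤ
minor M j a b = M (suc a) (punchIn j b)

laplaceTerm : ∀ {n} → (Fin (suc n) → Fin (suc n) → ℤ) → Fin (suc n) → ℤ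
laplaceTerm M j = signFin j * (M zero j * det (minor M j))

det-cong : ∀ {n} {M N : Fin n → Fin n → ℤ} → (∀ a b → M a b ≡ N a b) → det M ≡ det N
det-cong {zero}  M≗N = refl
det-cong {suc n} M≗N = sumFin-cong λ j →
  cong₂ (λ x y → signFin j * (x * y)) (M≗N zero j) (det-cong λ a b → M≗N (suc a) (punchIn j b))

det-scale-rows : ∀ {n} (r : Fin n → ℤ) (M : Fin n → Fin n → ℤ) →
                 det (λ a b → r a * M a b) ≡ product r * det M
det-scale-rows {zero}  r M = refl
det-scale-rows {suc n} r M = begin
  sumFin (λ j → signFin j * ((r zero * M zero j) * det (λ a b → r (suc a) * minor M j a b)))
    ≡⟨ sumFin-cong (λ j → cong (λ x → signFin j * ((r zero * M zero j) * x))
                               (det-scale-rows (r ∘ suc) (minor M j))) ⟩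
  sumFin (λ j → signFin j * ((r zero * M zero j) * (product (r ∘ suc) * det (minor M j))))
    ≡⟨ sumFin-cong (λ j → rearrange (signFin j) (r zero) (M zero j) (product (r ∘ suc)) (det (minor M j))) ⟩
  sumFin (λ j → product r * laplaceTerm M j)
    ≡⟨ *-distribˡ-sumFin (product r) (laplaceTerm M) ⟨
  product r * det M ∎
  where
  open ≡-Reasoning
  rearrange : ∀ s r₀ m R D → s * ((r₀ * m) * (R * D)) ≡ (r₀ * R) * (s * (m * D))
  rearrange = solve-∀

det-scale-columns : ∀ {n} (c : Fin n → ℤ) (M : Fin n → Fin n → ℤ) →
                    det (λ a b → M a b * c b) ≡ product c * det M
det-scale-columns {zero}  c M = refl
det-scale-columns {suc n} c M = begin
  sumFin (λ j → signFin j * ((M zero j * c j) * det (λ a b → minor M j a b * c (punchIn j b))))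
    ≡⟨ sumFin-cong (λ j → cong (λ x → signFin j * ((M zero j * c j) * x))
                               (det-scale-columns (c ∘ punchIn j) (minor M j))) ⟩
  sumFin (λ j → signFin j * ((M zero j * c j) * (product (c ∘ punchIn j) * det (minor M j))))
    ≡⟨ sumFin-cong (λ j → trans (rearrange (signFin j) (M zero j) (c j) (product (c ∘ punchIn j)) (det (minor M j)))
                                (cong (_* laplaceTerm M j) (sym (product-remove {i = j} c)))) ⟩
  sumFin (λ j → product c * laplaceTerm M j)
    ≡⟨ *-distribˡ-sumFin (product c) (laplaceTerm M) ⟨
  product c * det M ∎
  where
  open ≡-Reasoning
  rearrange : ∀ s m cⱼ C D → s * ((m * cⱼ) * (C * D)) ≡ (cⱼ * C) * (s * (m * D))
  rearrange = solve-∀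

det-conjugate-by-signs : ∀ {n} (s : Fin n → ℤ) (M : Fin n → Fin n → ℤ) → (∀ a → s a * s a ≡ 1ℤ) →
                         det (λ a b → (s a * M a b) * s b) ≡ det M
det-conjugate-by-signs {n} s M s²≡1 = begin
  det (λ a b → (s a * M a b) * s b)        ≡⟨ det-scale-columns s (λ a b → s a * M a b) ⟩
  product s * det (λ a b → s a * M a b)    ≡⟨ cong (product s *_) (det-scale-rows s M) ⟩
  product s * (product s * det M)          ≡⟨ *-assoc (product s) (product s) (det M) ⟨
  (product s * product s) * det M          ≡⟨ cong (_* det M) (product-distrib-* s s) ⟨
  product (λ a → s a * s a) * det M        ≡⟨ cong (_* det M) (trans (product-cong-≗ s²≡1) (product-replicate-one n)) ⟩
  1ℤ * det M                               ≡⟨ *-identityˡ (det M) ⟩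
  det M                                    ∎
  where open ≡-Reasoning

arcSign : Bool → ℤ
arcSign b = if b then + 1 else - (+ 1)

switchSign : Bool → ℤ
switchSign false = + 1
switchSign true  = - (+ 1)

arcSign-xor : ∀ w b → arcSign (w xor b) ≡ switchSign w * arcSign b
arcSign-xor false false = refl
arcSign-xor false true  = refl
arcSign-xor true  false = refl
arcSign-xor true  true  = refl

switchSign-squared : ∀ w → switchSign w * switchSign w ≡ 1ℤ
switchSign-squared false = refl
switchSign-squared true  = refl

skew-diagonal : ∀ {n} (T : Tournament n) i → skew T i i ≡ + 0
skew-diagonal T i with i ≟ i
... | yes _  = refl
... | no i≢i = contradiction refl i≢i

skew-arc : ∀ {n} (T : Tournament n) {i j} → i ≢ j → skew T i j ≡ arcSign (beats T i j)
skew-arc T {i} {j} i≢j with i ≟ j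
... | yes i≡j = contradiction i≡j i≢j
... | no _    = refl

-- Switching isomorphisms

xor-cancelˡ : ∀ w b → w xor (w xor b) ≡ b
xor-cancelˡ w b = trans (sym (xor-assoc w w b)) (cong (_xor b) (xor-same w))

if-not≡xor : ∀ w b → (if w then not b else b) ≡ w xor b
if-not≡xor false b = refl
if-not≡xor true  b = refl

beats-switch : ∀ {n} (T : Tournament n) W i j → beats (switch T W) i j ≡ (W i xor W j) xor beats T i j
beats-switch T W i j = if-not≡xor (W i xor W j) (beats T i j)

record SwitchingIso {n₁ n₂} (T₁ : Tournament n₁) (T₂ : Tournament n₂) : Set where
  field
    π       : Permutation n₁ n₂
    W       : Fin n₁ → Bool
    beats-π : ∀ i j → beats T₂ (π ⟨$⟩ʳ i) (π ⟨$⟩ʳ j) ≡ (W i xor W j) xor beats T₁ i j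

  sizes-equal : n₁ ≡ n₂
  sizes-equal = ↔⇒≡ π

  π-injective : ∀ {i j} → π ⟨$⟩ʳ i ≡ π ⟨$⟩ʳ j → i ≡ j
  π-injective {i} {j} πi≡πj = trans (sym (inverseˡ π)) (trans (cong (π ⟨$⟩ˡ_) πi≡πj) (inverseˡ π))

  ∀-via-π : {P : Fin n₂ → Set} → (∀ i → P (π ⟨$⟩ʳ i)) → ∀ y → P y
  ∀-via-π {P} P∘π y = subst P (inverseʳ π) (P∘π (π ⟨$⟩ˡ y))

fromSwitchingIsomorphic : ∀ {n₁ n₂} {T₁ : Tournament n₁} {T₂ : Tournament n₂} →
                          SwitchingIsomorphic T₁ T₂ → SwitchingIso T₁ T₂
fromSwitchingIsomorphic {T₁ = T₁} (W , π , π-iso) = record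
  { π = π ; W = W ; beats-π = λ i j → trans (π-iso i j) (beats-switch T₁ W i j) }

SwitchingIso-sym : ∀ {n₁ n₂} {T₁ : Tournament n₁} {T₂ : Tournament n₂} →
                   SwitchingIso T₁ T₂ → SwitchingIso T₂ T₁
SwitchingIso-sym {T₁ = T₁} {T₂} φ = record { π = flip π ; W = W ∘ (π ⟨$⟩ˡ_) ; beats-π = arcs }
  where
  open SwitchingIso φ
  arcs : ∀ i j → beats T₁ (π ⟨$⟩ˡ i) (π ⟨$⟩ˡ j) ≡ (W (π ⟨$⟩ˡ i) xor W (π ⟨$⟩ˡ j)) xor beats T₂ i j
  arcs i j = begin
    beats T₁ i′ j′                                   ≡⟨ xor-cancelˡ w (beats T₁ i′ j′) ⟨
    w xor (w xor beats T₁ i′ j′)                     ≡⟨ cong (w xor_) (beats-π i′ j′) ⟨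
    w xor beats T₂ (π ⟨$⟩ʳ i′) (π ⟨$⟩ʳ j′)           ≡⟨ cong₂ (λ x y → w xor beats T₂ x y) (inverseʳ π) (inverseʳ π) ⟩
    w xor beats T₂ i j                               ∎
    where
    open ≡-Reasoning
    i′ = π ⟨$⟩ˡ i
    j′ = π ⟨$⟩ˡ j
    w  = W i′ xor W j′

-- Invariance of the classes D_k

module _ {n₁ n₂} {T₁ : Tournament n₁} {T₂ : Tournament n₂} (φ : SwitchingIso T₁ T₂) where
  open SwitchingIso φ

  skew-π : ∀ i j → skew T₂ (π ⟨$⟩ʳ i) (π ⟨$⟩ʳ j) ≡ (switchSign (W i) * skew T₁ i j) * switchSign (W j)
  -- Matching on i ≟ j also evaluates skew T₁ i j on the right-hand side.
  skew-π i j with i ≟ j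
  ... | yes refl = begin
    skew T₂ (π ⟨$⟩ʳ i) (π ⟨$⟩ʳ i)                 ≡⟨ skew-diagonal T₂ (π ⟨$⟩ʳ i) ⟩
    + 0                                           ≡⟨ annihilate (switchSign (W i)) ⟩
    (switchSign (W i) * + 0) * switchSign (W i)   ∎
    where
    open ≡-Reasoning
    annihilate : ∀ s → + 0 ≡ (s * + 0) * s
    annihilate = solve-∀
  ... | no i≢j = begin
    skew T₂ (π ⟨$⟩ʳ i) (π ⟨$⟩ʳ j)                 ≡⟨ skew-arc T₂ (i≢j ∘ π-injective) ⟩
    arcSign (beats T₂ (π ⟨$⟩ʳ i) (π ⟨$⟩ʳ j))      ≡⟨ cong arcSign (trans (beats-π i j) (xor-assoc (W i) (W j) b)) ⟩
    arcSign (W i xor (W j xor b))                 ≡⟨ arcSign-xor (W i) (W j xor b) ⟩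
    sᵢ * arcSign (W j xor b)                      ≡⟨ cong (sᵢ *_) (arcSign-xor (W j) b) ⟩
    sᵢ * (sⱼ * arcSign b)                         ≡⟨ commute sᵢ sⱼ (arcSign b) ⟩
    (sᵢ * arcSign b) * sⱼ                         ∎
    where
    open ≡-Reasoning
    b  = beats T₁ i j
    sᵢ = switchSign (W i)
    sⱼ = switchSign (W j)
    commute : ∀ x y z → x * (y * z) ≡ (x * z) * y
    commute = solve-∀

  detInduced-π : ∀ {r} (f : Fin r → Fin n₂) → detInduced T₂ f ≡ detInduced T₁ ((π ⟨$⟩ˡ_) ∘ f)
  detInduced-π f = begin
    det (λ a b → skew T₂ (f a) (f b))
      ≡⟨ det-cong (λ a b → cong₂ (skew T₂) (sym (inverseʳ π {f a})) (sym (inverseʳ π {f b}))) ⟩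
    det (λ a b → skew T₂ (π ⟨$⟩ʳ g a) (π ⟨$⟩ʳ g b))
      ≡⟨ det-cong (λ a b → skew-π (g a) (g b)) ⟩
    det (λ a b → (s a * skew T₁ (g a) (g b)) * s b)
      ≡⟨ det-conjugate-by-signs s (λ a b → skew T₁ (g a) (g b)) (switchSign-squared ∘ W ∘ g) ⟩
    detInduced T₁ g ∎
    where
    open ≡-Reasoning
    g = (π ⟨$⟩ˡ_) ∘ f
    s = switchSign ∘ W ∘ g

  InD-transport : ∀ m → InD m T₁ → InD m T₂
  InD-transport m inD r f f-injective =
    subst (ℤ._≤ _) (sym (detInduced-π f)) (inD r ((π ⟨$⟩ˡ_) ∘ f) (f-injective ∘ ⁻¹-injective))
    where
    ⁻¹-injective : ∀ {x y} → π ⟨$⟩ˡ x ≡ π ⟨$⟩ˡ y → x ≡ y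
    ⁻¹-injective = SwitchingIso.π-injective (SwitchingIso-sym φ)

  InDprev-transport : ∀ m → InDprev m T₁ → InDprev m T₂
  InDprev-transport zero    ()
  InDprev-transport (suc m) = InD-transport m

Level-transport : ∀ {n₁ n₂} {T₁ : Tournament n₁} {T₂ : Tournament n₂} →
                  SwitchingIso T₁ T₂ → ∀ m → Level m T₁ → Level m T₂
Level-transport φ m (inD , ¬inDprev) =
  InD-transport φ m inD , ¬inDprev ∘ InDprev-transport (SwitchingIso-sym φ) m

-- Covertices and revertices

CRAssociatedBy : Bool → ∀ {n} → Tournament n → Fin n → Fin n → Set
CRAssociatedBy c {n} T u v =
  u ≢ v × (∀ (x : Fin n) → x ≢ u → x ≢ v → beats T u x ≡ c xor beats T v x)

By⇒CRAssociated : ∀ {n} {T : Tournament n} {u v} c → CRAssociatedBy c T u v → CRAssociated T u v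
By⇒CRAssociated false = inj₁
By⇒CRAssociated true  = inj₂

module _ {n₁ n₂} {T₁ : Tournament n₁} {T₂ : Tournament n₂} (φ : SwitchingIso T₁ T₂) where
  open SwitchingIso φ

  CRAssociatedBy-transport : ∀ c {u v} → CRAssociatedBy c T₁ u v →
                             CRAssociatedBy (c xor (W u xor W v)) T₂ (π ⟨$⟩ʳ u) (π ⟨$⟩ʳ v)
  CRAssociatedBy-transport c {u} {v} (u≢v , agree) = u≢v ∘ π-injective , ∀-via-π agree′
    where
    c′ = c xor (W u xor W v)
    agree′ : ∀ x → π ⟨$⟩ʳ x ≢ π ⟨$⟩ʳ u → π ⟨$⟩ʳ x ≢ π ⟨$⟩ʳ v →
             beats T₂ (π ⟨$⟩ʳ u) (π ⟨$⟩ʳ x) ≡ c′ xor beats T₂ (π ⟨$⟩ʳ v) (π ⟨$⟩ʳ x)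
    agree′ x x≢u x≢v = begin
      beats T₂ (π ⟨$⟩ʳ u) (π ⟨$⟩ʳ x)              ≡⟨ beats-π u x ⟩
      (W u xor W x) xor beats T₁ u x              ≡⟨ cong ((W u xor W x) xor_) (agree x (x≢u ∘ cong (π ⟨$⟩ʳ_)) (x≢v ∘ cong (π ⟨$⟩ʳ_))) ⟩
      (W u xor W x) xor (c xor beats T₁ v x)      ≡⟨ regroup c (W u) (W v) (W x) (beats T₁ v x) ⟩
      c′ xor ((W v xor W x) xor beats T₁ v x)     ≡⟨ cong (c′ xor_) (beats-π v x) ⟨
      c′ xor beats T₂ (π ⟨$⟩ʳ v) (π ⟨$⟩ʳ x)       ∎
      where
      open ≡-Reasoning
      regroup : ∀ c u v x b → (u xor x) xor (c xor b) ≡ (c xor (u xor v)) xor ((v xor x) xor b)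
      regroup = solve 5 (λ c u v x b → (u :+ x) :+ (c :+ b) := (c :+ (u :+ v)) :+ ((v :+ x) :+ b)) refl

  CRAssociated-transport : ∀ {u v} → CRAssociated T₁ u v → CRAssociated T₂ (π ⟨$⟩ʳ u) (π ⟨$⟩ʳ v)
  CRAssociated-transport {u} {v} (inj₁ covertices) =
    By⇒CRAssociated {T = T₂} (W u xor W v) (CRAssociatedBy-transport false covertices)
  CRAssociated-transport {u} {v} (inj₂ revertices) =
    By⇒CRAssociated {T = T₂} (not (W u xor W v)) (CRAssociatedBy-transport true revertices)

-- One-vertex extensions and 1-transitive blowups

module _ {n₁ n₂} {T₁ : Tournament n₁} {T₂ : Tournament n₂} (φ : SwitchingIso T₁ T₂) where
  open SwitchingIso φ

  pullback : (Fin n₂ → Bool) → Fin n₁ → Bool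
  pullback σ i = W i xor σ (π ⟨$⟩ʳ i)

  extend-SwitchingIso : ∀ σ → SwitchingIso (extend T₁ (pullback σ)) (extend T₂ σ)
  extend-SwitchingIso σ = record { π = lift₀ π ; W = false Vector.∷ W ; beats-π = arcs }
    where
    arcs : ∀ i j → beats (extend T₂ σ) (lift₀ π ⟨$⟩ʳ i) (lift₀ π ⟨$⟩ʳ j)
                 ≡ ((false Vector.∷ W) i xor (false Vector.∷ W) j) xor beats (extend T₁ (pullback σ)) i j
    arcs zero    zero    = refl
    arcs zero    (suc j) = sym (xor-cancelˡ (W j) (σ (π ⟨$⟩ʳ j)))
    arcs (suc i) zero    = arc-to-new-vertex (W i) (σ (π ⟨$⟩ʳ i))
      where
      -- the solver sees not s as true xor s, which it unfolds to
      arc-to-new-vertex : ∀ w s → not s ≡ (w xor false) xor not (w xor s)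
      arc-to-new-vertex = solve 2 (λ w s → con true :+ s := (w :+ con false) :+ (con true :+ (w :+ s))) refl
    arcs (suc i) (suc j) = beats-π i j

  blowup-SwitchingIso : ∀ i → SwitchingIso (blowup T₁ i) (blowup T₂ (π ⟨$⟩ʳ i))
  blowup-SwitchingIso i = record { π = lift₀ π ; W = W i Vector.∷ W ; beats-π = arcs }
    where
    unswitched : ∀ w b → b ≡ (w xor w) xor b
    unswitched w b = cong (_xor b) (sym (xor-same w))
    arcs : ∀ j k → beats (blowup T₂ (π ⟨$⟩ʳ i)) (lift₀ π ⟨$⟩ʳ j) (lift₀ π ⟨$⟩ʳ k)
                 ≡ ((W i Vector.∷ W) j xor (W i Vector.∷ W) k) xor beats (blowup T₁ i) j k
    arcs zero zero = unswitched (W i) false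
    arcs zero (suc k) with π ⟨$⟩ʳ k ≟ π ⟨$⟩ʳ i | k ≟ i
    ... | yes _     | yes refl = unswitched (W k) true
    ... | yes πk≡πi | no k≢i   = contradiction (π-injective πk≡πi) k≢i
    ... | no πk≢πi  | yes refl = contradiction refl πk≢πi
    ... | no _      | no _     = beats-π i k
    arcs (suc j) zero with π ⟨$⟩ʳ j ≟ π ⟨$⟩ʳ i | j ≟ i
    ... | yes _     | yes refl = unswitched (W j) false
    ... | yes πj≡πi | no j≢i   = contradiction (π-injective πj≡πi) j≢i
    ... | no πj≢πi  | yes refl = contradiction refl πj≢πi
    ... | no _      | no _     = beats-π j i
    arcs (suc j) (suc k) = beats-π j k

-- Diamonds

-- Diamond, generalised from tournaments to relations (Diamond T is IsDiamond (beats T) by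
-- definition) so that it can be decided on explicit relations on Fin 4.
IsDiamond : ∀ {n} → (Fin n → Fin n → Bool) → Set
IsDiamond {n} B =
  Σ (Fin n) λ a → Σ (Fin n) λ b → Σ (Fin n) λ c → Σ (Fin n) λ d →
    a ≢ b × a ≢ c × a ≢ d × b ≢ c × b ≢ d × c ≢ d ×
    (∀ x → x ≡ a ⊎ x ≡ b ⊎ x ≡ c ⊎ x ≡ d) ×
    B a b ≡ true × B b c ≡ true × B c a ≡ true ×
    ((B d a ≡ true × B d b ≡ true × B d c ≡ true) ⊎
     (B a d ≡ true × B b d ≡ true × B c d ≡ true))

diamond? : ∀ {n} (B : Fin n → Fin n → Bool) → Dec (IsDiamond B)
diamond? B = any? λ a → any? λ b → any? λ c → any? λ d →
  ¬? (a ≟ b) ×-dec ¬? (a ≟ c) ×-dec ¬? (a ≟ d) ×-dec ¬? (b ≟ c) ×-dec ¬? (b ≟ d) ×-dec ¬? (c ≟ d) ×-dec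
  all? (λ x → x ≟ a ⊎-dec x ≟ b ⊎-dec x ≟ c ⊎-dec x ≟ d) ×-dec
  arc a b ×-dec arc b c ×-dec arc c a ×-dec
  ((arc d a ×-dec arc d b ×-dec arc d c) ⊎-dec (arc a d ×-dec arc b d ×-dec arc c d))
  where
  arc : ∀ x y → Dec (B x y ≡ true)
  arc x y = B x y Bool.≟ true

IsDiamond-transport : ∀ {m n} {A : Fin m → Fin m → Bool} {B : Fin n → Fin n → Bool} (g : Fin m → Fin n) →
                      Injective _≡_ _≡_ g → StrictlySurjective _≡_ g → (∀ i j → B (g i) (g j) ≡ A i j) →
                      IsDiamond A → IsDiamond B
IsDiamond-transport {A = A} {B} g g-inj g-surj g-arcs
  (a , b , c , d , a≢b , a≢c , a≢d , b≢c , b≢d , c≢d , cover , ab , bc , ca , apex) =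
  g a , g b , g c , g d ,
  a≢b ∘ g-inj , a≢c ∘ g-inj , a≢d ∘ g-inj , b≢c ∘ g-inj , b≢d ∘ g-inj , c≢d ∘ g-inj ,
  cover′ , arc a b ab , arc b c bc , arc c a ca ,
  Sum.map (λ (da , db , dc) → arc d a da , arc d b db , arc d c dc)
          (λ (ad , bd , cd) → arc a d ad , arc b d bd , arc c d cd) apex
  where
  arc : ∀ x y → A x y ≡ true → B (g x) (g y) ≡ true
  arc x y xy = trans (g-arcs x y) xy
  cover′ : ∀ y → y ≡ g a ⊎ y ≡ g b ⊎ y ≡ g c ⊎ y ≡ g d
  cover′ y with g-surj y
  ... | k , refl = Sum.map (cong g) (Sum.map (cong g) (Sum.map (cong g) (cong g))) (cover k)

onFour : (ab ac ad bc bd cd : Bool) → Fin 4 → Fin 4 → Bool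
onFour ab ac ad bc bd cd i j = lookup (lookup arcs i) j
  where
  arcs : Vec (Vec Bool 4) 4
  arcs = (false  ∷ ab     ∷ ac     ∷ ad    ∷ []) ∷
         (not ab ∷ false  ∷ bc     ∷ bd    ∷ []) ∷
         (not ac ∷ not bc ∷ false  ∷ cd    ∷ []) ∷
         (not ad ∷ not bd ∷ not cd ∷ false ∷ []) ∷ []

reverse-arc : ∀ {n} (T : Tournament n) {i j b} → i ≢ j → beats T i j ≡ b → beats T j i ≡ not b
reverse-arc T {i} {j} i≢j i→j = trans (antisym T i j i≢j) (cong not i→j)

module _ {n} (T : Tournament n) {a b c d : Fin n}
         (a≢b : a ≢ b) (a≢c : a ≢ c) (a≢d : a ≢ d) (b≢c : b ≢ c) (b≢d : b ≢ d) (c≢d : c ≢ d)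
         {ab ac ad bc bd cd : Bool}
         (a→b : beats T a b ≡ ab) (a→c : beats T a c ≡ ac) (a→d : beats T a d ≡ ad)
         (b→c : beats T b c ≡ bc) (b→d : beats T b d ≡ bd) (c→d : beats T c d ≡ cd) where

  beats-onFour : ∀ i j → beats T (lookup (a ∷ b ∷ c ∷ d ∷ []) i) (lookup (a ∷ b ∷ c ∷ d ∷ []) j)
                       ≡ onFour ab ac ad bc bd cd i j
  beats-onFour 0F 0F = irrefl T a
  beats-onFour 0F 1F = a→b
  beats-onFour 0F 2F = a→c
  beats-onFour 0F 3F = a→d
  beats-onFour 1F 0F = reverse-arc T a≢b a→b
  beats-onFour 1F 1F = irrefl T b
  beats-onFour 1F 2F = b→c
  beats-onFour 1F 3F = b→d
  beats-onFour 2F 0F = reverse-arc T a≢c a→c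
  beats-onFour 2F 1F = reverse-arc T b≢c b→c
  beats-onFour 2F 2F = irrefl T c
  beats-onFour 2F 3F = c→d
  beats-onFour 3F 0F = reverse-arc T a≢d a→d
  beats-onFour 3F 1F = reverse-arc T b≢d b→d
  beats-onFour 3F 2F = reverse-arc T c≢d c→d
  beats-onFour 3F 3F = irrefl T d

∀-Bool? : {P : Bool → Set} → (∀ b → Dec (P b)) → Dec (∀ b → P b)
∀-Bool? P? with P? false | P? true
... | yes f | yes t = yes λ { false → f ; true → t }
... | no ¬f | _     = no λ P → ¬f (P false)
... | yes _ | no ¬t = no λ P → ¬t (P true)

switchedOnFour : Bool → Vec Bool 4 → Fin 4 → Fin 4 → Bool
switchedOnFour t ws i j = (lookup ws i xor lookup ws j) xor onFour true false t true t t i j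

-- onFour true false t true t t is the diamond a → b → c → a whose apex d is dominated iff t;
-- that all its switches are diamonds is checked by running diamond? on the 2⁵ cases.
switched-diamond : ∀ t w₀ w₁ w₂ w₃ → IsDiamond (switchedOnFour t (w₀ ∷ w₁ ∷ w₂ ∷ w₃ ∷ []))
switched-diamond = from-yes (∀-Bool? λ t → ∀-Bool? λ w₀ → ∀-Bool? λ w₁ → ∀-Bool? λ w₂ → ∀-Bool? λ w₃ →
                               diamond? (switchedOnFour t (w₀ ∷ w₁ ∷ w₂ ∷ w₃ ∷ [])))

apex-arcs : ∀ {n} (T : Tournament n) {a b c d} → a ≢ d → b ≢ d → c ≢ d →
            (beats T d a ≡ true × beats T d b ≡ true × beats T d c ≡ true) ⊎
            (beats T a d ≡ true × beats T b d ≡ true × beats T c d ≡ true) →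
            ∃ λ t → beats T a d ≡ t × beats T b d ≡ t × beats T c d ≡ t
apex-arcs T a≢d b≢d c≢d (inj₁ (d→a , d→b , d→c)) =
  false , reverse-arc T (≢-sym a≢d) d→a , reverse-arc T (≢-sym b≢d) d→b , reverse-arc T (≢-sym c≢d) d→c
apex-arcs T a≢d b≢d c≢d (inj₂ a→d,b→d,c→d) = true , a→d,b→d,c→d

⊎⇒∈ : ∀ {A : Set} {x a b c d : A} → x ≡ a ⊎ x ≡ b ⊎ x ≡ c ⊎ x ≡ d → x ∈ a ∷ b ∷ c ∷ d ∷ []
⊎⇒∈ (inj₁ x≡a)               = here x≡a
⊎⇒∈ (inj₂ (inj₁ x≡b))        = there (here x≡b)
⊎⇒∈ (inj₂ (inj₂ (inj₁ x≡c))) = there (there (here x≡c))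
⊎⇒∈ (inj₂ (inj₂ (inj₂ x≡d))) = there (there (there (here x≡d)))

module _ {n₁ n₂} {T₁ : Tournament n₁} {T₂ : Tournament n₂} (φ : SwitchingIso T₁ T₂) where
  open SwitchingIso φ

  Diamond-transport : Diamond T₁ → Diamond T₂
  Diamond-transport (a , b , c , d , a≢b , a≢c , a≢d , b≢c , b≢d , c≢d , cover , a→b , b→c , c→a , apex)
    with apex-arcs T₁ a≢d b≢d c≢d apex
  ... | t , a→d , b→d , c→d =
    IsDiamond-transport g g-injective g-surjective g-arcs (switched-diamond t (W a) (W b) (W c) (W d))
    where
    vs = a ∷ b ∷ c ∷ d ∷ []
    g : Fin 4 → Fin n₂
    g i = π ⟨$⟩ʳ lookup vs i
    distinct : Unique vs
    distinct = (a≢b ∷ a≢c ∷ a≢d ∷ []) ∷ (b≢c ∷ b≢d ∷ []) ∷ (c≢d ∷ []) ∷ [] ∷ []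
    g-injective : Injective _≡_ _≡_ g
    g-injective = lookup-injective distinct _ _ ∘ π-injective
    g-surjective : StrictlySurjective _≡_ g
    g-surjective = ∀-via-π λ x → let x∈vs = ⊎⇒∈ (cover x) in
      index x∈vs , cong (π ⟨$⟩ʳ_) (sym (lookup-index x∈vs))
    g-arcs : ∀ i j → beats T₂ (g i) (g j) ≡ switchedOnFour t (map W vs) i j
    g-arcs i j = begin
      beats T₂ (g i) (g j)
        ≡⟨ beats-π (lookup vs i) (lookup vs j) ⟩
      (W (lookup vs i) xor W (lookup vs j)) xor beats T₁ (lookup vs i) (lookup vs j)
        ≡⟨ cong₂ _xor_ (sym (cong₂ _xor_ (lookup-map i W vs) (lookup-map j W vs)))
                       (beats-onFour T₁ a≢b a≢c a≢d b≢c b≢d c≢d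
                                     a→b (reverse-arc T₁ (≢-sym a≢c) c→a) a→d b→c b→d c→d i j) ⟩
      switchedOnFour t (map W vs) i j ∎
      where open ≡-Reasoning

-- Invariance of the CR properties

NonCRExtensionsLeaveD : ℕ → ∀ {n} → Tournament n → Set
NonCRExtensionsLeaveD m {n} T = ∀ (σ : Fin n → Bool) → NonCRVertex T σ → ¬ InD m (extend T σ)

module _ {n₁ n₂} {T₁ : Tournament n₁} {T₂ : Tournament n₂} (φ : SwitchingIso T₁ T₂) where
  open SwitchingIso φ

  NonCRExtensionsLeaveD-transport : ∀ m → NonCRExtensionsLeaveD m T₁ → NonCRExtensionsLeaveD m T₂
  NonCRExtensionsLeaveD-transport m leave σ nonCR inD =
    leave (pullback φ σ)
          (λ i → nonCR (π ⟨$⟩ʳ i) ∘ CRAssociated-transport ψ)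
          (InD-transport (SwitchingIso-sym ψ) m inD)
    where
    ψ = extend-SwitchingIso φ σ

SwitchingInvariant : (∀ {n} → Tournament n → Set) → Set
SwitchingInvariant P =
  ∀ {n₁ n₂} {T₁ : Tournament n₁} {T₂ : Tournament n₂} → SwitchingIso T₁ T₂ → P T₁ → P T₂

IsCR-invariant : SwitchingInvariant IsCR
IsCR-invariant φ (m , level , kind) =
  m , Level-transport φ m level ,
  Sum.map (trans (sym sizes-equal))
    (Sum.map (trans (sym sizes-equal))
      (Sum.map (Diamond-transport φ) (NonCRExtensionsLeaveD-transport φ m))) kind
  where open SwitchingIso φ

IsStrongCR-invariant : SwitchingInvariant IsStrongCR
IsStrongCR-invariant φ (cr , blowups-cr) =
  IsCR-invariant φ cr , ∀-via-π (λ i → IsCR-invariant (blowup-SwitchingIso φ i) (blowups-cr i))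
  where open SwitchingIso φ

IsBasic-invariant : SwitchingInvariant IsBasic
IsBasic-invariant φ (n≥4 , noneAssociated) =
  subst (ℕ._≥ 4) sizes-equal n≥4 ,
  λ _ _ → noneAssociated _ _ ∘ CRAssociated-transport (SwitchingIso-sym φ)
  where open SwitchingIso φ

×-invariant : ∀ {P Q : ∀ {n} → Tournament n → Set} →
              SwitchingInvariant P → SwitchingInvariant Q → SwitchingInvariant (λ T → P T × Q T)
×-invariant P-inv Q-inv φ = Product.map (P-inv φ) (Q-inv φ)

theorem4p6 : ∀ {n₁ n₂} (T₁ : Tournament n₁) (T₂ : Tournament n₂) →
    SwitchingIsomorphic T₁ T₂ →
    (IsCR T₁ ⇔ IsCR T₂) ×
    (IsStrongCR T₁ ⇔ IsStrongCR T₂) ×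
    (IsBasic T₁ ⇔ IsBasic T₂) ×
    (IsBasicCR T₁ ⇔ IsBasicCR T₂) ×
    (IsBasicStrongCR T₁ ⇔ IsBasicStrongCR T₂)
theorem4p6 T₁ T₂ T₁≃T₂ =
  respects IsCR-invariant ,
  respects IsStrongCR-invariant ,
  respects IsBasic-invariant ,
  respects (×-invariant IsBasic-invariant IsCR-invariant) ,
  respects (×-invariant IsBasic-invariant IsStrongCR-invariant)
  where
  φ = fromSwitchingIsomorphic T₁≃T₂
  respects : ∀ {P : ∀ {n} → Tournament n → Set} → SwitchingInvariant P → P T₁ ⇔ P T₂
  respects P-inv = mk⇔ (P-inv φ) (P-inv (SwitchingIso-sym φ))
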